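{- If $G$ is a graph with a min-max clique covering satisfying simple intersection, then its compressed cliques graph $\mathcal{C}(G)$ does not contain a suspended cycle.
   Context: A clique is a set of vertices inducing a complete subgraph; maximal if no vertex can be added. A clique covering is a set of cliques such that every edge lies inside one of them; $\mathrm{cc}(G)$ is the minimum size of a clique covering; a min-max clique covering is one of size $\mathrm{cc}(G)$ all of whose cliques are maximal. A covering $\{C_1,\dots,C_\ell\}$ has simple intersection if no vertex lies in three distinct $C_i$. For such a covering define, for $i\neq j$, $C_{i,j}=C_i\cap C_j$, and $C_{i,i}=C_i\setminus\bigcup_{j\neq i}C_j$. The compressed cliques graph $\mathcal{C}(G)$ has one vertex $v_{i,j}$ for each nonempty $C_{i,j}$ (unordered pairs, $i=j$ allowed), distinct $v_{i,j},v_{i',j'}$ adjacent iff $\{i,j\}\cap\{i',j'\}\neq\emptyset$. A cycle $u_1u_2\cdots u_tu_1$ in a graph $X$ is suspended if exactly one of $u_1,\dots,u_t$ has degree larger than two in $X$ and all the others have degree two in $X$. -}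

module Defs where

open import Data.Nat using (ℕ; suc)
open import Data.Fin using (Fin; zero; suc; inject₁; fromℕ; _≤_)
open import Data.Fin.Subset using (Subset; _∈_; _∉_)
open import Data.Product using (Σ; ∃; _×_; _,_)
open import Data.Sum using (_⊎_)
open import Relation.Binary.PropositionalEquality using (_≡_; _≢_)
open import Relation.Nullary using (¬_)

record Graph : Set₁ where
  field
    n      : ℕ
    Adj    : Fin n → Fin n → Set
    sym    : ∀ {u v} → Adj u v → Adj v u
    irrefl : ∀ {u} → ¬ Adj u u
open Graph public

module _ (G : Graph) where

  IsClique : Subset (n G) → Set
  IsClique C = ∀ u v → u ∈ C → v ∈ C → u ≢ v → Adj G u v

  IsMaximalClique : Subset (n G) → Set
  IsMaximalClique C =
    IsClique C × (∀ w → w ∉ C → ∃ λ u → u ∈ C × u ≢ w × ¬ Adj G w u)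

  IsCliqueCovering : (ℓ : ℕ) → (Fin ℓ → Subset (n G)) → Set
  IsCliqueCovering ℓ C =
    (∀ i → IsClique (C i)) ×
    (∀ u v → Adj G u v → ∃ λ i → u ∈ C i × v ∈ C i)

  IsCC : ℕ → Set
  IsCC ℓ = (∃ λ C → IsCliqueCovering ℓ C) ×
           (∀ m (D : Fin m → Subset (n G)) → IsCliqueCovering m D → ℓ Data.Nat.≤ m)

  IsMinMaxCliqueCovering : (ℓ : ℕ) → (Fin ℓ → Subset (n G)) → Set
  IsMinMaxCliqueCovering ℓ C =
    IsCliqueCovering ℓ C × IsCC ℓ × (∀ i → IsMaximalClique (C i))

SimpleIntersection : ∀ {m ℓ} → (Fin ℓ → Subset m) → Set
SimpleIntersection {m} {ℓ} C =
  ∀ (v : Fin m) (i j k : Fin ℓ) → i ≢ j → j ≢ k → i ≢ k →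
    v ∈ C i → v ∈ C j → v ∈ C k → Data.Empty.⊥
  where import Data.Empty

-- The compressed cliques graph.  Unordered pairs {i,j} (i = j allowed)
-- are represented by ordered pairs (i , j) with i ≤ j.

module Compressed {m ℓ : ℕ} (C : Fin ℓ → Subset m) where

  Pair : Set
  Pair = Fin ℓ × Fin ℓ

  InPart : Fin m → Fin ℓ → Fin ℓ → Set
  InPart v i j = (i ≡ j × v ∈ C i × (∀ k → k ≢ i → v ∉ C k))
               ⊎ (i ≢ j × v ∈ C i × v ∈ C j)

  IsVertex : Pair → Set
  IsVertex (i , j) = i ≤ j × ∃ λ v → InPart v i j

  CAdj : Pair → Pair → Set
  CAdj (i , j) (i' , j') =
    ((i , j) ≢ (i' , j')) ×
    (i ≡ i' ⊎ i ≡ j' ⊎ j ≡ i' ⊎ j ≡ j')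

  DegGt2 : Pair → Set
  DegGt2 p = ∃ λ a → ∃ λ b → ∃ λ c →
    IsVertex a × IsVertex b × IsVertex c ×
    CAdj p a × CAdj p b × CAdj p c ×
    a ≢ b × b ≢ c × a ≢ c

  DegEq2 : Pair → Set
  DegEq2 p = ∃ λ a → ∃ λ b →
    IsVertex a × IsVertex b × CAdj p a × CAdj p b × a ≢ b ×
    (∀ c → IsVertex c → CAdj p c → c ≡ a ⊎ c ≡ b)

  -- a cycle u₀ u₁ … u_{t-1} u₀ of length t = k + 3 in 𝒞(G)
  IsCycle : (k : ℕ) → (Fin (suc (suc (suc k))) → Pair) → Set
  IsCycle k u =
    (∀ x → IsVertex (u x)) ×
    (∀ x y → u x ≡ u y → x ≡ y) ×
    (∀ (x : Fin (suc (suc k))) → CAdj (u (inject₁ x)) (u (suc x))) ×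
    CAdj (u (fromℕ (suc (suc k)))) (u zero)

  IsSuspendedCycle : (k : ℕ) → (Fin (suc (suc (suc k))) → Pair) → Set
  IsSuspendedCycle k u =
    IsCycle k u ×
    (∃ λ x → DegGt2 (u x) × (∀ y → y ≢ x → DegEq2 (u y)))

  HasSuspendedCycle : Set
  HasSuspendedCycle = ∃ λ k → ∃ λ u → IsSuspendedCycle k u

-- Label the vertex v_{i,j} of 𝒞(G) by i and j; two vertices are adjacent iff they share a label.
-- In a minimum covering no clique contains another, so for cliques i ≠ j some nonempty part lies
-- in C_j but not in C_i.  Hence on a path f – g – g′ with g and g′ of degree two, g shares with f
-- a label carried by no other vertex: a third carrier of that label, or g being a loop v_{i,i},
-- would give g or g′ a third neighbour.  The branch vertex f of a suspended cycle receives such a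
-- private label from each of its two cycle neighbours; the two labels differ, so they are all the
-- labels of f, and f has no neighbours besides those two, contradicting its degree.
module Submission where

open import Defs hiding (sym)
open import Data.Nat using (ℕ; zero; suc; _≤_)
open import Data.Nat.Properties using (n≮n; m≢1+n+m)
open import Data.Fin using (Fin; zero; suc; toℕ; fromℕ; inject₁; punchIn; punchOut; _≟_)
open import Data.Fin.Properties using (punchIn-punchOut; toℕ-inject₁; any?; ≤-total; ≤-refl)
open import Data.Fin.Subset using (Subset; _∈_; _∉_; _⊆_; _⊈_)
open import Data.Fin.Subset.Properties using (_∈?_)
open import Data.Product using (∃; _×_; _,_; proj₁; proj₂)
open import Data.Product.Properties using (≡-dec)
open import Data.Sum using (_⊎_; inj₁; inj₂)
open import Data.Empty using (⊥; ⊥-elim)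
open import Function using (_∘_)
open import Relation.Binary.PropositionalEquality
  using (_≡_; _≢_; refl; sym; trans; cong; subst; ≢-sym)
open import Relation.Nullary using (¬_; Dec; yes; no)
open import Relation.Nullary.Decidable using (¬?; _×-dec_; decidable-stable)

no-three-distinct-in-pair : ∀ {A : Set} {x y a b c : A} →
  a ≡ x ⊎ a ≡ y → b ≡ x ⊎ b ≡ y → c ≡ x ⊎ c ≡ y → a ≢ b → b ≢ c → a ≢ c → ⊥
no-three-distinct-in-pair (inj₁ p) (inj₁ q) _        a≢b _   _   = a≢b (trans p (sym q))
no-three-distinct-in-pair (inj₂ p) (inj₂ q) _        a≢b _   _   = a≢b (trans p (sym q))
no-three-distinct-in-pair (inj₁ p) (inj₂ q) (inj₁ r) _   _   a≢c = a≢c (trans p (sym r))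
no-three-distinct-in-pair (inj₁ p) (inj₂ q) (inj₂ r) _   b≢c _   = b≢c (trans q (sym r))
no-three-distinct-in-pair (inj₂ p) (inj₁ q) (inj₁ r) _   b≢c _   = b≢c (trans q (sym r))
no-three-distinct-in-pair (inj₂ p) (inj₁ q) (inj₂ r) _   _   a≢c = a≢c (trans p (sym r))

⊈⇒∃∈∉ : ∀ {m} {p q : Subset m} → p ⊈ q → ∃ λ w → w ∈ p × w ∉ q
⊈⇒∃∈∉ {p = p} {q} p⊈q with any? (λ w → w ∈? p ×-dec ¬? (w ∈? q))
... | yes witness = witness
... | no ∄ = ⊥-elim (p⊈q λ {w} w∈p → decidable-stable (w ∈? q) (λ w∉q → ∄ (w , w∈p , w∉q)))

module _ (G : Graph) where

  covering-without : ∀ {ℓ} {C : Fin (suc ℓ) → Subset (n G)} {i j} → i ≢ j → C j ⊆ C i →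
    IsCliqueCovering G (suc ℓ) C → IsCliqueCovering G ℓ (C ∘ punchIn j)
  covering-without {C = C} {i} {j} i≢j Cj⊆Ci (cliques , covers) = cliques ∘ punchIn j , covers′
    where
    covered-avoiding-j : ∀ {u v} → Adj G u v → ∃ λ k → j ≢ k × u ∈ C k × v ∈ C k
    covered-avoiding-j {u} {v} uv with covers u v uv
    ... | k , u∈Ck , v∈Ck with k ≟ j
    ... | yes refl = i , ≢-sym i≢j , Cj⊆Ci u∈Ck , Cj⊆Ci v∈Ck
    ... | no k≢j   = k , ≢-sym k≢j , u∈Ck , v∈Ck

    covers′ : ∀ u v → Adj G u v → ∃ λ x → u ∈ C (punchIn j x) × v ∈ C (punchIn j x)
    covers′ u v uv with covered-avoiding-j uv
    ... | k , j≢k , u∈Ck , v∈Ck = punchOut j≢k , reindex u∈Ck , reindex v∈Ck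
      where
      reindex : ∀ {w} → w ∈ C k → w ∈ C (punchIn j (punchOut j≢k))
      reindex = subst (λ k → _ ∈ C k) (sym (punchIn-punchOut j≢k))

  minimum-covering⇒antichain : ∀ {ℓ} {C : Fin ℓ → Subset (n G)} → IsCliqueCovering G ℓ C →
    (∀ m D → IsCliqueCovering G m D → ℓ ≤ m) → ∀ {i j} → i ≢ j → C j ⊈ C i
  minimum-covering⇒antichain {suc ℓ} covering minimum i≢j Cj⊆Ci =
    n≮n ℓ (minimum ℓ _ (covering-without i≢j Cj⊆Ci covering))

data LastOrInject : ∀ {m} → Fin (suc m) → Set where
  last   : ∀ {m} → LastOrInject (fromℕ m)
  inject : ∀ {m} (y : Fin m) → LastOrInject (inject₁ y)

lastOrInject : ∀ {m} (x : Fin (suc m)) → LastOrInject x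
lastOrInject {zero}  zero    = last
lastOrInject {suc m} zero    = inject zero
lastOrInject {suc m} (suc x) with lastOrInject x
... | last     = last
... | inject y = inject (suc y)

next : ∀ {m} → Fin (suc m) → Fin (suc m)
next x with lastOrInject x
... | last     = zero
... | inject y = suc y

prev : ∀ {m} → Fin (suc m) → Fin (suc m)
prev {m} zero = fromℕ m
prev (suc y)  = inject₁ y

next-suc-last : ∀ {m} {x : Fin (suc m)} → next x ≡ zero → next (suc x) ≡ zero
next-suc-last {x = x} eq with lastOrInject x
... | last = refl

next-suc-inject : ∀ {m} {x : Fin (suc m)} {y} → next x ≡ suc y → next (suc x) ≡ suc (suc y)
next-suc-inject {x = x} eq with lastOrInject x
... | inject _ = cong suc eq

next-fromℕ : ∀ m → next (fromℕ m) ≡ zero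
next-fromℕ zero    = refl
next-fromℕ (suc m) = next-suc-last (next-fromℕ m)

next-inject₁ : ∀ {m} (y : Fin m) → next (inject₁ y) ≡ suc y
next-inject₁ zero    = refl
next-inject₁ (suc y) = next-suc-inject (next-inject₁ y)

prev-next : ∀ {m} (x : Fin (suc m)) → prev (next x) ≡ x
prev-next x with lastOrInject x
... | last     = refl
... | inject _ = refl

next-prev : ∀ {m} (x : Fin (suc m)) → next (prev x) ≡ x
next-prev {m} zero = next-fromℕ m
next-prev (suc y)  = next-inject₁ y

next≢prev : ∀ {k} (x : Fin (suc (suc (suc k)))) → next x ≢ prev x
next≢prev x with lastOrInject x
... | last           = λ ()
... | inject zero    = λ ()
... | inject (suc y) = λ eq →
  m≢1+n+m (toℕ y) (sym (trans (cong toℕ eq) (trans (toℕ-inject₁ _) (toℕ-inject₁ y))))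

next²≢id : ∀ {k} (x : Fin (suc (suc (suc k)))) → next (next x) ≢ x
next²≢id x eq = next≢prev x (trans (sym (prev-next (next x))) (cong prev eq))

prev²≢id : ∀ {k} (x : Fin (suc (suc (suc k)))) → prev (prev x) ≢ x
prev²≢id x eq = next≢prev (prev x) (trans (next-prev x) (sym eq))

module _ {m ℓ : ℕ} (C : Fin ℓ → Subset m) where
  open Compressed C

  infix 4 _∈ₚ_ _∉ₚ_

  _∈ₚ_ : Fin ℓ → Pair → Set
  i ∈ₚ (p , q) = p ≡ i ⊎ q ≡ i

  _∉ₚ_ : Fin ℓ → Pair → Set
  i ∉ₚ e = ¬ i ∈ₚ e

  ∈ₚ-∉ₚ⇒≢ : ∀ {i a b} → i ∈ₚ a → i ∉ₚ b → a ≢ b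
  ∈ₚ-∉ₚ⇒≢ i∈a i∉b refl = i∉b i∈a

  ∈ₚ-loop : ∀ {i r} → r ∈ₚ (i , i) → i ≡ r
  ∈ₚ-loop (inj₁ i≡r) = i≡r
  ∈ₚ-loop (inj₂ i≡r) = i≡r

  ∈ₚ-two : ∀ {e i j r} → i ∈ₚ e → j ∈ₚ e → i ≢ j → r ∈ₚ e → r ≡ i ⊎ r ≡ j
  ∈ₚ-two (inj₁ p≡i) _          _   (inj₁ p≡r) = inj₁ (trans (sym p≡r) p≡i)
  ∈ₚ-two (inj₂ q≡i) _          _   (inj₂ q≡r) = inj₁ (trans (sym q≡r) q≡i)
  ∈ₚ-two (inj₁ p≡i) (inj₂ q≡j) _   (inj₂ q≡r) = inj₂ (trans (sym q≡r) q≡j)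
  ∈ₚ-two (inj₂ q≡i) (inj₁ p≡j) _   (inj₁ p≡r) = inj₂ (trans (sym p≡r) p≡j)
  ∈ₚ-two (inj₁ p≡i) (inj₁ p≡j) i≢j _          = ⊥-elim (i≢j (trans (sym p≡i) p≡j))
  ∈ₚ-two (inj₂ q≡i) (inj₂ q≡j) i≢j _          = ⊥-elim (i≢j (trans (sym q≡i) q≡j))

  other-label : ∀ {e i} → i ∈ₚ e → e ≢ (i , i) → ∃ λ k → k ∈ₚ e × k ≢ i
  other-label {p , q} (inj₁ refl) e≢ii = q , inj₂ refl , λ { refl → e≢ii refl }
  other-label {p , q} (inj₂ refl) e≢ii = p , inj₁ refl , λ { refl → e≢ii refl }

  CAdj⇒shared-label : ∀ {a b} → CAdj a b → ∃ λ i → i ∈ₚ a × i ∈ₚ b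
  CAdj⇒shared-label {p , q} (_ , inj₁ p≡p′)                 = p , inj₁ refl , inj₁ (sym p≡p′)
  CAdj⇒shared-label {p , q} (_ , inj₂ (inj₁ p≡q′))          = p , inj₁ refl , inj₂ (sym p≡q′)
  CAdj⇒shared-label {p , q} (_ , inj₂ (inj₂ (inj₁ q≡p′)))   = q , inj₂ refl , inj₁ (sym q≡p′)
  CAdj⇒shared-label {p , q} (_ , inj₂ (inj₂ (inj₂ q≡q′)))   = q , inj₂ refl , inj₂ (sym q≡q′)

  shared-label⇒CAdj : ∀ {a b i} → i ∈ₚ a → i ∈ₚ b → a ≢ b → CAdj a b
  shared-label⇒CAdj (inj₁ p≡i) (inj₁ p′≡i) a≢b = a≢b , inj₁ (trans p≡i (sym p′≡i))
  shared-label⇒CAdj (inj₁ p≡i) (inj₂ q′≡i) a≢b = a≢b , inj₂ (inj₁ (trans p≡i (sym q′≡i)))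
  shared-label⇒CAdj (inj₂ q≡i) (inj₁ p′≡i) a≢b = a≢b , inj₂ (inj₂ (inj₁ (trans q≡i (sym p′≡i))))
  shared-label⇒CAdj (inj₂ q≡i) (inj₂ q′≡i) a≢b = a≢b , inj₂ (inj₂ (inj₂ (trans q≡i (sym q′≡i))))

  CAdj-sym : ∀ {a b} → CAdj a b → CAdj b a
  CAdj-sym ab with CAdj⇒shared-label ab
  ... | _ , i∈a , i∈b = shared-label⇒CAdj i∈b i∈a (≢-sym (proj₁ ab))

  neighbours-in-pair⇒¬DegGt2 : ∀ {e a b} →
    (∀ c → IsVertex c → CAdj e c → c ≡ a ⊎ c ≡ b) → ¬ DegGt2 e
  neighbours-in-pair⇒¬DegGt2 among (x , y , z , vx , vy , vz , ex , ey , ez , x≢y , y≢z , x≢z) =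
    no-three-distinct-in-pair (among x vx ex) (among y vy ey) (among z vz ez) x≢y y≢z x≢z

  DegEq2⇒¬DegGt2 : ∀ {e} → DegEq2 e → ¬ DegGt2 e
  DegEq2⇒¬DegGt2 (_ , _ , _ , _ , _ , _ , _ , among) = neighbours-in-pair⇒¬DegGt2 among

  part-containing : ∀ {w j} → w ∈ C j →
    ∃ λ e → IsVertex e × j ∈ₚ e × (∀ {r} → r ∈ₚ e → w ∈ C r)
  part-containing {w} {j} w∈Cj with any? (λ k → ¬? (k ≟ j) ×-dec (w ∈? C k))
  ... | no ∄ =
    (j , j) , (≤-refl , w , inj₁ (refl , w∈Cj , λ k k≢j w∈Ck → ∄ (k , k≢j , w∈Ck))) , inj₁ refl ,
    λ r∈jj → subst (λ r → w ∈ C r) (∈ₚ-loop r∈jj) w∈Cj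
  ... | yes (k , k≢j , w∈Ck) with ≤-total j k
  ... | inj₁ j≤k = (j , k) , (j≤k , w , inj₂ (≢-sym k≢j , w∈Cj , w∈Ck)) , inj₁ refl ,
                   λ { (inj₁ refl) → w∈Cj ; (inj₂ refl) → w∈Ck }
  ... | inj₂ k≤j = (k , j) , (k≤j , w , inj₂ (k≢j , w∈Ck , w∈Cj)) , inj₂ refl ,
                   λ { (inj₁ refl) → w∈Ck ; (inj₂ refl) → w∈Cj }

  module _ {k} {u : Fin (suc (suc (suc k))) → Pair} (cycle : IsCycle k u) where

    cycle-next : ∀ x → CAdj (u x) (u (next x))
    cycle-next x with lastOrInject x
    ... | last     = proj₂ (proj₂ (proj₂ cycle))
    ... | inject y = proj₁ (proj₂ (proj₂ cycle)) y

    cycle-prev : ∀ x → CAdj (u (prev x)) (u x)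
    cycle-prev zero    = proj₂ (proj₂ (proj₂ cycle))
    cycle-prev (suc y) = proj₁ (proj₂ (proj₂ cycle)) y

    cycle-≢ : ∀ {x y} → x ≢ y → u x ≢ u y
    cycle-≢ {x} {y} x≢y = x≢y ∘ proj₁ (proj₂ cycle) x y

  module _ (antichain : ∀ {i j} → i ≢ j → C j ⊈ C i) where

    vertex-with-label-without : ∀ {i j} → i ≢ j → ∃ λ e → IsVertex e × j ∈ₚ e × i ∉ₚ e
    vertex-with-label-without i≢j with ⊈⇒∃∈∉ (antichain i≢j)
    ... | w , w∈Cj , w∉Ci with part-containing w∈Cj
    ... | e , ve , j∈e , w∈labels = e , ve , j∈e , w∉Ci ∘ w∈labels

    -- The third neighbour of v is a part carrying the second label k of v but not i.
    crowded⇒DegGt2 : ∀ {v a b i k} → IsVertex a → IsVertex b → a ≢ b → v ≢ a → v ≢ b →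
      i ∈ₚ v → i ∈ₚ a → i ∈ₚ b → k ∈ₚ v → i ≢ k → DegGt2 v
    crowded⇒DegGt2 va vb a≢b v≢a v≢b i∈v i∈a i∈b k∈v i≢k
      with vertex-with-label-without i≢k
    ... | e , ve , k∈e , i∉e =
      _ , _ , e , va , vb , ve ,
      shared-label⇒CAdj i∈v i∈a v≢a , shared-label⇒CAdj i∈v i∈b v≢b ,
      shared-label⇒CAdj k∈v k∈e (∈ₚ-∉ₚ⇒≢ i∈v i∉e) ,
      a≢b , ∈ₚ-∉ₚ⇒≢ i∈b i∉e , ∈ₚ-∉ₚ⇒≢ i∈a i∉e

    PrivateLabel : Pair → Pair → Set
    PrivateLabel g f = ∃ λ i → i ∈ₚ g × i ∈ₚ f × (∀ c → IsVertex c → i ∈ₚ c → c ≡ g ⊎ c ≡ f)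

    loop-neighbour-DegGt2 : ∀ {i f g} → IsVertex (i , i) → IsVertex f →
      CAdj (i , i) f → CAdj (i , i) g → f ≢ g → DegGt2 g
    loop-neighbour-DegGt2 vii vf ii-f ii-g f≢g
      with CAdj⇒shared-label ii-f | CAdj⇒shared-label ii-g
    ... | r , r∈ii , r∈f | s , s∈ii , s∈g
      with subst (_∈ₚ _) (sym (∈ₚ-loop r∈ii)) r∈f | subst (_∈ₚ _) (sym (∈ₚ-loop s∈ii)) s∈g
    ... | i∈f | i∈g with other-label i∈g (≢-sym (proj₁ ii-g))
    ... | k , k∈g , k≢i =
      crowded⇒DegGt2 vii vf (proj₁ ii-f) (≢-sym (proj₁ ii-g)) (≢-sym f≢g)
        i∈g (inj₁ refl) i∈f k∈g (≢-sym k≢i)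

    DegEq2⇒PrivateLabel : ∀ {p q f} → p ≢ q → DegEq2 (p , q) → IsVertex f →
      CAdj (p , q) f → PrivateLabel (p , q) f
    DegEq2⇒PrivateLabel {p} {q} {f} p≢q deg₂ vf g-f with CAdj⇒shared-label g-f
    ... | i , i∈g , i∈f with other-label i∈g (λ { refl → p≢q refl })
    ... | k , k∈g , k≢i = i , i∈g , i∈f , only-g-f
      where
      _≟ₚ_ : (a b : Pair) → Dec (a ≡ b)
      _≟ₚ_ = ≡-dec _≟_ _≟_

      only-g-f : ∀ c → IsVertex c → i ∈ₚ c → c ≡ (p , q) ⊎ c ≡ f
      only-g-f c vc i∈c with c ≟ₚ (p , q) | c ≟ₚ f
      ... | yes c≡g | _       = inj₁ c≡g
      ... | no _    | yes c≡f = inj₂ c≡f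
      ... | no c≢g  | no c≢f  = ⊥-elim (DegEq2⇒¬DegGt2 deg₂
        (crowded⇒DegGt2 vf vc (≢-sym c≢f) (proj₁ g-f) (≢-sym c≢g) i∈g i∈f i∈c k∈g (≢-sym k≢i)))

    path⇒PrivateLabel : ∀ {f g g′} → IsVertex f → IsVertex g → CAdj g f → CAdj g g′ → f ≢ g′ →
      DegEq2 g → DegEq2 g′ → PrivateLabel g f
    path⇒PrivateLabel {g = p , q} vf vg g-f g-g′ f≢g′ deg₂ deg₂′ with p ≟ q
    ... | yes refl = ⊥-elim (DegEq2⇒¬DegGt2 deg₂′ (loop-neighbour-DegGt2 vg vf g-f g-g′ f≢g′))
    ... | no p≢q   = DegEq2⇒PrivateLabel p≢q deg₂ vf g-f

    two-PrivateLabels⇒¬DegGt2 : ∀ {f g h} → IsVertex h → h ≢ f → g ≢ h →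
      PrivateLabel g f → PrivateLabel h f → ¬ DegGt2 f
    two-PrivateLabels⇒¬DegGt2 {h = h} vh h≢f g≢h (i , _ , i∈f , only-g-f) (i′ , i′∈h , i′∈f , only-h-f)
      with i ≟ i′
    ... | yes refl with only-g-f h vh i′∈h
    ...   | inj₁ h≡g = λ _ → g≢h (sym h≡g)
    ...   | inj₂ h≡f = λ _ → h≢f h≡f
    two-PrivateLabels⇒¬DegGt2 {f} {g} {h} vh h≢f g≢h (i , _ , i∈f , only-g-f) (i′ , i′∈h , i′∈f , only-h-f)
      | no i≢i′ = neighbours-in-pair⇒¬DegGt2 neighbour-g-or-h
      where
      not-f : ∀ {c x} → CAdj f c → c ≡ x ⊎ c ≡ f → c ≡ x
      not-f _   (inj₁ c≡x) = c≡x
      not-f f-c (inj₂ c≡f) = ⊥-elim (proj₁ f-c (sym c≡f))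

      neighbour-g-or-h : ∀ c → IsVertex c → CAdj f c → c ≡ g ⊎ c ≡ h
      neighbour-g-or-h c vc f-c with CAdj⇒shared-label f-c
      ... | r , r∈f , r∈c with ∈ₚ-two i∈f i′∈f i≢i′ r∈f
      ... | inj₁ refl = inj₁ (not-f f-c (only-g-f c vc r∈c))
      ... | inj₂ refl = inj₂ (not-f f-c (only-h-f c vc r∈c))

    no-suspended-cycle : ¬ HasSuspendedCycle
    no-suspended-cycle (k , u , cycle , x , branch , others) =
      two-PrivateLabels⇒¬DegGt2 (vertex (prev x)) (proj₁ (cycle-prev cycle x))
        (cycle-≢ cycle (next≢prev x)) private-next private-prev branch
      where
      vertex : ∀ y → IsVertex (u y)
      vertex = proj₁ cycle

      next≢id : next x ≢ x
      next≢id = proj₁ (cycle-next cycle x) ∘ cong u ∘ sym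

      prev≢id : prev x ≢ x
      prev≢id = proj₁ (cycle-prev cycle x) ∘ cong u

      private-next : PrivateLabel (u (next x)) (u x)
      private-next = path⇒PrivateLabel (vertex x) (vertex (next x))
        (CAdj-sym (cycle-next cycle x)) (cycle-next cycle (next x))
        (cycle-≢ cycle (≢-sym (next²≢id x))) (others _ next≢id) (others _ (next²≢id x))

      private-prev : PrivateLabel (u (prev x)) (u x)
      private-prev = path⇒PrivateLabel (vertex x) (vertex (prev x))
        (cycle-prev cycle x) (CAdj-sym (cycle-prev cycle (prev x)))
        (cycle-≢ cycle (≢-sym (prev²≢id x))) (others _ prev≢id) (others _ (prev²≢id x))

lemma9p2 : (G : Graph) (ℓ : ℕ) (C : Fin ℓ → Subset (n G)) →
    IsMinMaxCliqueCovering G ℓ C → SimpleIntersection C →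
    ¬ Compressed.HasSuspendedCycle C
lemma9p2 G ℓ C (covering , (_ , minimum) , _) _ =
  no-suspended-cycle C (minimum-covering⇒antichain G covering minimum)
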